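{- Let $G$ be a group of size $m$ with $\dim G=d$. Then $\dim G^k\ge\frac{d}{\log m}\cdot\log|G^k|$ for every integer $k\ge1$. In particular, $\dim \mathrm{S}_3^k\ge\frac{3}{\log 6}\cdot\log|\mathrm{S}_3^k|$ for every integer $k\ge1$. Furthermore, for every integer $k\ge1$ there is a dissociated set $Z\subseteq \mathrm{S}_3^k$ of size $|Z|=\frac{3}{\log6}\cdot\log|\mathrm{S}_3^k|$ such that every element of $Z$ has order $2$ in $\mathrm{S}_3^k$.
   Context: All logarithms are natural. $G^k$ denotes the $k$-fold direct product of $G$, and $\mathrm{S}_3$ is the symmetric group on three elements. For a group $G$ with identity $e$, a subset $S\subseteq G$ is dissociated if there is no solution to $g_1^{\varepsilon_1}\cdots g_m^{\varepsilon_m}=e$ with $m\ge1$, distinct $g_1,\dots,g_m\in S$ and $\varepsilon_1,\dots,\varepsilon_m\in\{ -1,1\}$. For a finite $A\subseteq G$, $\dim A$ is the maximum cardinality of a dissociated subset of $A$; $\dim G$ is this quantity for $A=G$. -}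

module Defs where

open import Level using (Level; _⊔_)
open import Data.Nat using (ℕ; zero; suc)
open import Data.Bool using (Bool; true; false)
open import Data.Fin using (Fin)
open import Data.List using (List; []; _∷_; map; length)
open import Data.Product using (_×_; _,_; proj₁; Σ; ∃)
open import Relation.Nullary using (¬_)
open import Relation.Binary.PropositionalEquality
  using (_≡_; refl; sym; trans; cong)
open import Function.Definitions using (Injective; Surjective)
open import Algebra.Bundles using (Group)
open import Algebra.Structures using (IsGroup)
import Algebra.Construct.DirectProduct as DP
import Algebra.Construct.Terminal as Terminal
import Data.List.Membership.Setoid as SetoidMembership
import Data.List.Relation.Unary.Unique.Setoid as SetoidUnique
open import Data.Fin.Permutation as Perm
  using (Permutation′; _⟨$⟩ʳ_; _⟨$⟩ˡ_; _∘ₚ_; inverseˡ; inverseʳ)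

private
  variable
    c ℓ : Level

module _ (G : Group c ℓ) where
  open Group G

  -- A finite subset of G is represented by a duplicate-free list
  -- (duplicate-free with respect to the group's equality _≈_).
  IsFinSubset : List Carrier → Set (c ⊔ ℓ)
  IsFinSubset S = SetoidUnique.Unique setoid S

  _∈G_ : Carrier → List Carrier → Set (c ⊔ ℓ)
  x ∈G S = SetoidMembership._∈_ setoid x S

  signed : Carrier × Bool → Carrier
  signed (g , true)  = g
  signed (g , false) = g ⁻¹

  signedProduct : List (Carrier × Bool) → Carrier
  signedProduct []       = ε
  signedProduct (p ∷ ps) = signed p ∙ signedProduct ps

  Dissociated : List Carrier → Set (c ⊔ ℓ)
  Dissociated S =
    (p : Carrier × Bool) (ps : List (Carrier × Bool)) →
    SetoidUnique.Unique setoid (map proj₁ (p ∷ ps)) →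
    (∀ {g} → SetoidMembership._∈_ setoid g (map proj₁ (p ∷ ps)) → g ∈G S) →
    ¬ (signedProduct (p ∷ ps) ≈ ε)

  IsDim : ℕ → Set (c ⊔ ℓ)
  IsDim d =
    (Σ (List Carrier) λ S → IsFinSubset S × Dissociated S × length S ≡ d)
    × (∀ S → IsFinSubset S → Dissociated S → length S Data.Nat.≤ d)

  HasSize : ℕ → Set (c ⊔ ℓ)
  HasSize n = Σ (Fin n → Carrier) λ f →
    Injective _≡_ _≈_ f × Surjective _≡_ _≈_ f

  HasOrder2 : Carrier → Set ℓ
  HasOrder2 x = (¬ (x ≈ ε)) × (x ∙ x ≈ ε)

_^ᴳ_ : Group c ℓ → ℕ → Group c ℓ
G ^ᴳ zero    = Terminal.group
G ^ᴳ (suc k) = DP.group G (G ^ᴳ k)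

S₃ : Group Level.zero Level.zero
S₃ = record
  { Carrier = Permutation′ 3
  ; _≈_ = Perm._≈_
  ; _∙_ = _∘ₚ_
  ; ε = Perm.id
  ; _⁻¹ = Perm.flip
  ; isGroup = record
    { isMonoid = record
      { isSemigroup = record
        { isMagma = record
          { isEquivalence = record
            { refl = λ i → refl
            ; sym = λ p i → sym (p i)
            ; trans = λ p q i → trans (p i) (q i)
            }
          ; ∙-cong = λ {x} {y} {u} {v} p q i →
              trans (cong (u ⟨$⟩ʳ_) (p i)) (q (y ⟨$⟩ʳ i))
          }
        ; assoc = λ x y z i → refl
        }
      ; identity = (λ x i → refl) , (λ x i → refl)
      }
    ; inverse = (λ x i → inverseʳ x) , (λ x i → inverseˡ x)
    ; ⁻¹-cong = λ {x} {y} p i →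
        trans (cong (x ⟨$⟩ˡ_) (sym (inverseʳ y)))
          (trans (cong (x ⟨$⟩ˡ_) (sym (p (y ⟨$⟩ˡ i)))) (inverseˡ x))
    }
  }

-- If S is a dissociated subset of G, the copies of S in the k coordinates of Gᵏ form a
-- dissociated subset of size k·|S|: a relation among them projects to a relation among
-- elements of S in some coordinate.  Hence dim Gᵏ ≥ k·d, i.e. |Gᵏ|^d = m^(kd) ≤ m^(dim Gᵏ).
-- In S₃ the three transpositions form a dissociated set of elements of order 2, which
-- gives d = 3 there and the set Z.
module Submission where

open import Defs
open import Level using (Level; _⊔_)
open import Data.Nat using (ℕ; zero; suc; _≤_; _^_; _*_; _+_; NonZero)
open import Data.Nat.Properties using (≤-antisym; ^-monoʳ-≤; ^-*-assoc; module ≤-Reasoning)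
open import Data.Bool using (Bool; true; false)
open import Data.Empty using (⊥-elim)
open import Data.Fin using (Fin; combine; remQuot; _≟_)
open import Data.Fin.Patterns using (0F; 1F; 2F)
open import Data.Fin.Properties using (injective⇒≤; combine-remQuot; remQuot-combine; all?; any?)
open import Data.Fin.Permutation as Perm using (Permutation′; _⟨$⟩ʳ_; _∘ₚ_; transpose)
open import Data.List using (List; []; _∷_; length; map; _++_; allFin)
open import Data.List.Properties using (length-++; length-map)
open import Data.List.Relation.Unary.All as All using (All; []; _∷_; tabulateₛ; reduce)
import Data.List.Relation.Unary.All.Properties as All
open import Data.List.Relation.Unary.Any using (here; there)
open import Data.List.Relation.Unary.AllPairs as AllPairs using (AllPairs; []; _∷_; allPairs?)
import Data.List.Relation.Unary.AllPairs.Properties as AllPairs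
import Data.List.Relation.Unary.Unique.Setoid.Properties as Unique
import Data.List.Relation.Unary.Unique.Propositional.Properties as UniqueP
open import Data.List.Membership.Setoid.Properties using (∈-resp-≈; ∈-map⁻; ∈-++⁻)
open import Data.Product using (Σ; ∃; _×_; _,_; proj₁; proj₂; map₁)
open import Data.Sum using (inj₁; inj₂)
open import Data.Unit.Polymorphic using (tt)
open import Data.Vec using (_∷_; []; lookup)
open import Function using (_∘_)
open import Function.Bundles using (Injection)
open import Function.Properties.Inverse using (↔⇒↣)
open import Relation.Nullary using (¬_; Dec)
open import Relation.Nullary.Decidable using (toWitness; ¬?; _→-dec_; _×-dec_)
import Relation.Binary.PropositionalEquality as ≡
open ≡ using (_≡_; _≢_)
open import Algebra.Bundles using (Group)
import Algebra.Construct.DirectProduct as DP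
import Algebra.Construct.Terminal as Terminal
import Algebra.Properties.Group as GroupProperties
import Relation.Binary.Reasoning.Setoid as SetoidReasoning

private
  variable
    a c ℓ : Level
    m n k D N : ℕ

module _ (G : Group c ℓ) where
  open Group G
  open import Data.List.Membership.Setoid setoid using (_∈_)

  HasSize-≤ : HasSize G m → HasSize G n → m ≤ n
  HasSize-≤ {m} {n} (f , f-injective , _) (g , _ , g-surjective) =
    injective⇒≤ reindex-injective
    where
    reindex : Fin m → Fin n
    reindex i = proj₁ (g-surjective (f i))

    g∘reindex≈f : ∀ i → g (reindex i) ≈ f i
    g∘reindex≈f i = proj₂ (g-surjective (f i)) ≡.refl

    reindex-injective : ∀ {i j} → reindex i ≡ reindex j → i ≡ j
    reindex-injective {i} {j} eq = f-injective (begin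
      f i             ≈⟨ sym (g∘reindex≈f i) ⟩
      g (reindex i)   ≡⟨ ≡.cong g eq ⟩
      g (reindex j)   ≈⟨ g∘reindex≈f j ⟩
      f j             ∎)
      where open SetoidReasoning setoid

  HasSize-unique : HasSize G m → HasSize G n → m ≡ n
  HasSize-unique |G|≡m |G|≡n = ≤-antisym (HasSize-≤ |G|≡m |G|≡n) (HasSize-≤ |G|≡n |G|≡m)

  HasSize⇒NonZero : HasSize G m → NonZero m
  HasSize⇒NonZero {zero} (_ , _ , surjective) with () ← proj₁ (surjective ε)
  HasSize⇒NonZero {suc m} _ = _

  signed-cong : ∀ b {x y} → x ≈ y → signed G (x , b) ≈ signed G (y , b)
  signed-cong true  x≈y = x≈y
  signed-cong false x≈y = ⁻¹-cong x≈y

  signed-ε : ∀ b {x} → x ≈ ε → signed G (x , b) ≈ ε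
  signed-ε true  x≈ε = x≈ε
  signed-ε false x≈ε = trans (⁻¹-cong x≈ε) (GroupProperties.ε⁻¹≈ε G)

  signed-involution : ∀ b {x y} → x ≈ y → y ⁻¹ ≈ y → signed G (x , b) ≈ y
  signed-involution true  x≈y _      = x≈y
  signed-involution false x≈y y⁻¹≈y = trans (⁻¹-cong x≈y) y⁻¹≈y

  []-dissociated : Dissociated G []
  []-dissociated _ _ _ ⊆[] _ with () ← ⊆[] (here refl)

  Dissociated⇒ε∉ : ∀ {S} → Dissociated G S → ¬ (ε ∈ S)
  Dissociated⇒ε∉ dissociated ε∈S =
    dissociated (ε , true) [] ([] ∷ []) (λ { (here g≈ε) → ∈-resp-≈ setoid (sym g≈ε) ε∈S })
      (identityʳ ε)

HasSize-terminal : HasSize (Terminal.group {c} {ℓ}) 1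
HasSize-terminal = (λ _ → tt) , (λ { {0F} {0F} _ → ≡.refl }) , λ _ → 0F , λ _ → tt

HasSize-× : (G H : Group c ℓ) → HasSize G m → HasSize H n → HasSize (DP.group G H) (m * n)
HasSize-× {m = m} {n = n} G H (f , f-injective , f-surjective) (g , g-injective , g-surjective) =
  F , F-injective , F-surjective
  where
  module G = Group G
  module H = Group H

  F : Fin (m * n) → G.Carrier × H.Carrier
  F i = f (proj₁ (remQuot {m} n i)) , g (proj₂ (remQuot {m} n i))

  F-injective : ∀ {i j} → Group._≈_ (DP.group G H) (F i) (F j) → i ≡ j
  F-injective {i} {j} (fi≈fj , gi≈gj) = begin
    i                                  ≡⟨ combine-remQuot {m} n i ⟨
    combine (proj₁ qi) (proj₂ qi)      ≡⟨ ≡.cong₂ combine (f-injective fi≈fj) (g-injective gi≈gj) ⟩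
    combine (proj₁ qj) (proj₂ qj)      ≡⟨ combine-remQuot {m} n j ⟩
    j                                  ∎
    where
    open ≡.≡-Reasoning
    qi = remQuot {m} n i
    qj = remQuot {m} n j

  F-surjective : ∀ y → ∃ λ i → ∀ {z} → z ≡ i → Group._≈_ (DP.group G H) (F z) y
  F-surjective (u , v) = combine x y , λ { ≡.refl →
      G.trans (G.reflexive (≡.cong (f ∘ proj₁) (remQuot-combine x y)))
              (proj₂ (f-surjective u) ≡.refl)
    , H.trans (H.reflexive (≡.cong (g ∘ proj₂) (remQuot-combine x y)))
              (proj₂ (g-surjective v) ≡.refl) }
    where
    x = proj₁ (f-surjective u)
    y = proj₁ (g-surjective v)

HasSize-^ᴳ : (G : Group c ℓ) → HasSize G m → ∀ k → HasSize (G ^ᴳ k) (m ^ k)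
HasSize-^ᴳ G |G|≡m zero    = HasSize-terminal
HasSize-^ᴳ G |G|≡m (suc k) = HasSize-× G (G ^ᴳ k) |G|≡m (HasSize-^ᴳ G |G|≡m k)

HasSize-^ᴳ-unique : (G : Group c ℓ) → HasSize G m → ∀ k → HasSize (G ^ᴳ k) N → N ≡ m ^ k
HasSize-^ᴳ-unique G |G|≡m k |Gᵏ|≡N = HasSize-unique (G ^ᴳ k) |Gᵏ|≡N (HasSize-^ᴳ G |G|≡m k)

module DirectProduct (G H : Group c ℓ) where
  private
    module G = Group G
    module H = Group H
  open import Data.List.Membership.Setoid G.setoid using () renaming (_∈_ to _∈₁_)
  open import Data.List.Membership.Setoid H.setoid using () renaming (_∈_ to _∈₂_)

  K : Group c ℓ
  K = DP.group G H
  open Group K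
  open import Data.List.Membership.Setoid setoid using (_∈_)

  _⊕_ : List G.Carrier → List H.Carrier → List Carrier
  S ⊕ T = map (_, H.ε) S ++ map (G.ε ,_) T

  proj₁-signedProduct : ∀ ps → proj₁ (signedProduct K ps) ≡ signedProduct G (map (map₁ proj₁) ps)
  proj₁-signedProduct []                 = ≡.refl
  proj₁-signedProduct ((x , true)  ∷ ps) = ≡.cong (proj₁ x G.∙_) (proj₁-signedProduct ps)
  proj₁-signedProduct ((x , false) ∷ ps) = ≡.cong (proj₁ x G.⁻¹ G.∙_) (proj₁-signedProduct ps)

  proj₂-signedProduct : ∀ ps → proj₂ (signedProduct K ps) ≡ signedProduct H (map (map₁ proj₂) ps)
  proj₂-signedProduct []                 = ≡.refl
  proj₂-signedProduct ((x , true)  ∷ ps) = ≡.cong (proj₂ x H.∙_) (proj₂-signedProduct ps)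
  proj₂-signedProduct ((x , false) ∷ ps) = ≡.cong (proj₂ x H.⁻¹ H.∙_) (proj₂-signedProduct ps)

  module _ (S : List G.Carrier) (T : List H.Carrier) where

    data Split : List (Carrier × Bool) → List (G.Carrier × Bool) → List (H.Carrier × Bool) →
                 Set (c ⊔ ℓ) where
      []    : Split [] [] []
      left  : ∀ {x b ps qs rs s} → x ≈ (s , H.ε) → s ∈₁ S → Split ps qs rs →
              Split ((x , b) ∷ ps) ((s , b) ∷ qs) rs
      right : ∀ {x b ps qs rs t} → x ≈ (G.ε , t) → t ∈₂ T → Split ps qs rs →
              Split ((x , b) ∷ ps) qs ((t , b) ∷ rs)

    split : ∀ ps → (∀ {g} → g ∈ map proj₁ ps → g ∈ S ⊕ T) → ∃ λ qs → ∃ (Split ps qs)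
    split [] _ = [] , [] , []
    split ((x , b) ∷ ps) ⊆S⊕T
      with qs , rs , ps-split ← split ps (⊆S⊕T ∘ there)
         | ∈-++⁻ setoid (map (_, H.ε) S) (⊆S⊕T (here refl))
    ... | inj₁ x∈S×e = let s , s∈S , x≈ = ∈-map⁻ G.setoid setoid x∈S×e
                       in (s , b) ∷ qs , rs , left x≈ s∈S ps-split
    ... | inj₂ x∈e×T = let t , t∈T , x≈ = ∈-map⁻ H.setoid setoid x∈e×T
                       in qs , (t , b) ∷ rs , right x≈ t∈T ps-split

    private
      variable
        ps : List (Carrier × Bool)
        qs : List (G.Carrier × Bool)
        rs : List (H.Carrier × Bool)

    split-proj₁ : Split ps qs rs → signedProduct G (map (map₁ proj₁) ps) G.≈ signedProduct G qs
    split-proj₁ []                      = G.refl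
    split-proj₁ (left {b = b} x≈ _ sp)  = G.∙-cong (signed-cong G b (proj₁ x≈)) (split-proj₁ sp)
    split-proj₁ (right {b = b} x≈ _ sp) =
      G.trans (G.∙-cong (signed-ε G b (proj₁ x≈)) (split-proj₁ sp)) (G.identityˡ _)

    split-proj₂ : Split ps qs rs → signedProduct H (map (map₁ proj₂) ps) H.≈ signedProduct H rs
    split-proj₂ []                      = H.refl
    split-proj₂ (left {b = b} x≈ _ sp)  =
      H.trans (H.∙-cong (signed-ε H b (proj₂ x≈)) (split-proj₂ sp)) (H.identityˡ _)
    split-proj₂ (right {b = b} x≈ _ sp) = H.∙-cong (signed-cong H b (proj₂ x≈)) (split-proj₂ sp)

    split-⊆ˡ : Split ps qs rs → ∀ {g} → g ∈₁ map proj₁ qs → g ∈₁ S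
    split-⊆ˡ (left _ s∈S _)  (here g≈s) = ∈-resp-≈ G.setoid (G.sym g≈s) s∈S
    split-⊆ˡ (left _ _ sp)   (there g∈) = split-⊆ˡ sp g∈
    split-⊆ˡ (right _ _ sp)  g∈         = split-⊆ˡ sp g∈

    split-⊆ʳ : Split ps qs rs → ∀ {g} → g ∈₂ map proj₁ rs → g ∈₂ T
    split-⊆ʳ (left _ _ sp)   g∈         = split-⊆ʳ sp g∈
    split-⊆ʳ (right _ t∈T _) (here g≈t) = ∈-resp-≈ H.setoid (H.sym g≈t) t∈T
    split-⊆ʳ (right _ _ sp)  (there g∈) = split-⊆ʳ sp g∈

    split-allˡ : ∀ {x s} → Split ps qs rs → x ≈ (s , H.ε) →
                 All (x ≉_) (map proj₁ ps) → All (s G.≉_) (map proj₁ qs)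
    split-allˡ []             _  []            = []
    split-allˡ (left y≈ _ sp) x≈ (x≉y ∷ x≉ps) =
      (λ s≈s′ → x≉y (trans x≈ (trans (s≈s′ , H.refl) (sym y≈)))) ∷ split-allˡ sp x≈ x≉ps
    split-allˡ (right _ _ sp) x≈ (_ ∷ x≉ps)   = split-allˡ sp x≈ x≉ps

    split-allʳ : ∀ {x t} → Split ps qs rs → x ≈ (G.ε , t) →
                 All (x ≉_) (map proj₁ ps) → All (t H.≉_) (map proj₁ rs)
    split-allʳ []              _  []            = []
    split-allʳ (left _ _ sp)   x≈ (_ ∷ x≉ps)   = split-allʳ sp x≈ x≉ps
    split-allʳ (right y≈ _ sp) x≈ (x≉y ∷ x≉ps) =
      (λ t≈t′ → x≉y (trans x≈ (trans (G.refl , t≈t′) (sym y≈)))) ∷ split-allʳ sp x≈ x≉ps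

    split-uniqueˡ : Split ps qs rs → AllPairs _≉_ (map proj₁ ps) → AllPairs G._≉_ (map proj₁ qs)
    split-uniqueˡ []              []              = []
    split-uniqueˡ (left x≈ _ sp)  (x≉ps ∷ ps!)    = split-allˡ sp x≈ x≉ps ∷ split-uniqueˡ sp ps!
    split-uniqueˡ (right _ _ sp)  (_ ∷ ps!)       = split-uniqueˡ sp ps!

    split-uniqueʳ : Split ps qs rs → AllPairs _≉_ (map proj₁ ps) → AllPairs H._≉_ (map proj₁ rs)
    split-uniqueʳ []              []              = []
    split-uniqueʳ (left _ _ sp)   (_ ∷ ps!)       = split-uniqueʳ sp ps!
    split-uniqueʳ (right x≈ _ sp) (x≉ps ∷ ps!)    = split-allʳ sp x≈ x≉ps ∷ split-uniqueʳ sp ps!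

    -- A relation over S ⊕ T projects to a relation over S, unless all its letters lie in {e} × T.
    ⊕-dissociated : Dissociated G S → Dissociated H T → Dissociated K (S ⊕ T)
    ⊕-dissociated S-dissociated T-dissociated p ps distinct ⊆S⊕T w≈ε
      with split (p ∷ ps) ⊆S⊕T
    ... | q ∷ qs , _ , sp = S-dissociated q qs (split-uniqueˡ sp distinct) (split-⊆ˡ sp) (begin
      signedProduct G (q ∷ qs)                     ≈⟨ split-proj₁ sp ⟨
      signedProduct G (map (map₁ proj₁) (p ∷ ps))  ≡⟨ proj₁-signedProduct (p ∷ ps) ⟨
      proj₁ (signedProduct K (p ∷ ps))             ≈⟨ proj₁ w≈ε ⟩
      G.ε                                          ∎)
      where open SetoidReasoning G.setoid
    ... | [] , r ∷ rs , sp = T-dissociated r rs (split-uniqueʳ sp distinct) (split-⊆ʳ sp) (begin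
      signedProduct H (r ∷ rs)                     ≈⟨ split-proj₂ sp ⟨
      signedProduct H (map (map₁ proj₂) (p ∷ ps))  ≡⟨ proj₂-signedProduct (p ∷ ps) ⟨
      proj₂ (signedProduct K (p ∷ ps))             ≈⟨ proj₂ w≈ε ⟩
      H.ε                                          ∎)
      where open SetoidReasoning H.setoid

    ⊕-unique : IsFinSubset G S → IsFinSubset H T → ¬ (G.ε ∈₁ S) → IsFinSubset K (S ⊕ T)
    ⊕-unique S-unique T-unique ε∉S =
      Unique.++⁺ setoid (Unique.map⁺ G.setoid setoid proj₁ S-unique)
                        (Unique.map⁺ H.setoid setoid proj₂ T-unique) disjoint
      where
      disjoint : ∀ {v} → ¬ (v ∈ map (_, H.ε) S × v ∈ map (G.ε ,_) T)
      disjoint (v∈S×e , v∈e×T) =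
        let s , s∈S , v≈s,e = ∈-map⁻ G.setoid setoid v∈S×e
            _ , _ ,   v≈e,t = ∈-map⁻ H.setoid setoid v∈e×T
        in ε∉S (∈-resp-≈ G.setoid (proj₁ (trans (sym v≈s,e) v≈e,t)) s∈S)

    length-⊕ : length (S ⊕ T) ≡ length S + length T
    length-⊕ = ≡.trans (length-++ (map (_, H.ε) S))
                       (≡.cong₂ _+_ (length-map (_, H.ε) S) (length-map (G.ε ,_) T))

    ⊕-order2 : All (HasOrder2 G) S → All (HasOrder2 H) T → All (HasOrder2 K) (S ⊕ T)
    ⊕-order2 S-order2 T-order2 =
      All.++⁺ (All.map⁺ (All.map embed₁ S-order2)) (All.map⁺ (All.map embed₂ T-order2))
      where
      embed₁ : ∀ {s} → HasOrder2 G s → HasOrder2 K (s , H.ε)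
      embed₁ (s≉ε , s²≈ε) = s≉ε ∘ proj₁ , s²≈ε , H.identityˡ H.ε
      embed₂ : ∀ {t} → HasOrder2 H t → HasOrder2 K (G.ε , t)
      embed₂ (t≉ε , t²≈ε) = t≉ε ∘ proj₂ , G.identityˡ G.ε , t²≈ε

module _ (G : Group c ℓ) (S : List (Group.Carrier G)) where
  coordinateCopies : ∀ k → List (Group.Carrier (G ^ᴳ k))
  coordinateCopies zero    = []
  coordinateCopies (suc k) = S ⊕ coordinateCopies k
    where open DirectProduct G (G ^ᴳ k) using (_⊕_)

  coordinateCopies-dissociated : Dissociated G S → ∀ k → Dissociated (G ^ᴳ k) (coordinateCopies k)
  coordinateCopies-dissociated S-dissociated zero    = []-dissociated (G ^ᴳ zero)
  coordinateCopies-dissociated S-dissociated (suc k) =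
    ⊕-dissociated S (coordinateCopies k) S-dissociated (coordinateCopies-dissociated S-dissociated k)
    where open DirectProduct G (G ^ᴳ k)

  coordinateCopies-unique : IsFinSubset G S → Dissociated G S →
                            ∀ k → IsFinSubset (G ^ᴳ k) (coordinateCopies k)
  coordinateCopies-unique S-unique S-dissociated zero    = []
  coordinateCopies-unique S-unique S-dissociated (suc k) =
    ⊕-unique S (coordinateCopies k)
      S-unique (coordinateCopies-unique S-unique S-dissociated k) (Dissociated⇒ε∉ G S-dissociated)
    where open DirectProduct G (G ^ᴳ k)

  length-coordinateCopies : ∀ k → length (coordinateCopies k) ≡ k * length S
  length-coordinateCopies zero    = ≡.refl
  length-coordinateCopies (suc k) =
    ≡.trans (length-⊕ S (coordinateCopies k)) (≡.cong (length S +_) (length-coordinateCopies k))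
    where open DirectProduct G (G ^ᴳ k)

  coordinateCopies-order2 : All (HasOrder2 G) S →
                            ∀ k → All (HasOrder2 (G ^ᴳ k)) (coordinateCopies k)
  coordinateCopies-order2 S-order2 zero    = []
  coordinateCopies-order2 S-order2 (suc k) =
    ⊕-order2 S (coordinateCopies k) S-order2 (coordinateCopies-order2 S-order2 k)
    where open DirectProduct G (G ^ᴳ k)

  dim-^ᴳ-≥ : IsFinSubset G S → Dissociated G S → ∀ k → IsDim (G ^ᴳ k) D → k * length S ≤ D
  dim-^ᴳ-≥ S-unique S-dissociated k (_ , maximal) =
    ≡.subst (_≤ _) (length-coordinateCopies k)
      (maximal _ (coordinateCopies-unique S-unique S-dissociated k)
                 (coordinateCopies-dissociated S-dissociated k))

  -- Taking logarithms, this is dim Gᵏ ≥ (length S / log m) · log |Gᵏ|.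
  dim-^ᴳ-size-bound : HasSize G m → IsFinSubset G S → Dissociated G S →
                      ∀ k → IsDim (G ^ᴳ k) D → HasSize (G ^ᴳ k) N → N ^ length S ≤ m ^ D
  dim-^ᴳ-size-bound {m = m} {D = D} {N = N} |G|≡m S-unique S-dissociated k dim≡D |Gᵏ|≡N = begin
    N ^ length S        ≡⟨ ≡.cong (_^ length S) (HasSize-^ᴳ-unique G |G|≡m k |Gᵏ|≡N) ⟩
    (m ^ k) ^ length S  ≡⟨ ^-*-assoc m k (length S) ⟩
    m ^ (k * length S)  ≤⟨ ^-monoʳ-≤ m ⦃ HasSize⇒NonZero G |G|≡m ⦄
                                      (dim-^ᴳ-≥ S-unique S-dissociated k dim≡D) ⟩
    m ^ D               ∎
    where open ≤-Reasoning

module _ (G : Group c ℓ) {A : Set a} (f : A → Group.Carrier G) where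
  open Group G
  open import Data.List.Membership.Setoid setoid using (_∈_)

  positiveWord : List A → List (Carrier × Bool)
  positiveWord = map (λ i → f i , true)

  private
    Indexing : List (Carrier × Bool) → Set (c ⊔ ℓ ⊔ a)
    Indexing = All (λ q → ∃ λ i → proj₁ q ≈ f i)

    indexing : ∀ {xs} qs → (∀ {g} → g ∈ map proj₁ qs → g ∈ map f xs) → Indexing qs
    indexing qs ⊆image = All.map⁻ (tabulateₛ setoid λ g∈ →
      let i , _ , g≈fi = ∈-map⁻ (≡.setoid A) setoid (⊆image g∈) in i , g≈fi)

    word≈positiveWord : (∀ i → f i ⁻¹ ≈ f i) → ∀ {qs} (ix : Indexing qs) →
                        signedProduct G qs ≈ signedProduct G (positiveWord (reduce proj₁ ix))
    word≈positiveWord involutive {[]}          []                = refl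
    word≈positiveWord involutive {(_ , b) ∷ _} ((i , x≈fi) ∷ ix) =
      ∙-cong (signed-involution G b x≈fi (involutive i)) (word≈positiveWord involutive ix)

    indexing-all : ∀ {qs x i} (ix : Indexing qs) → x ≈ f i →
                   All (x ≉_) (map proj₁ qs) → All (i ≢_) (reduce proj₁ ix)
    indexing-all []                x≈fi []            = []
    indexing-all ((j , y≈fj) ∷ ix) x≈fi (x≉y ∷ x≉qs) =
      (λ { ≡.refl → x≉y (trans x≈fi (sym y≈fj)) }) ∷ indexing-all ix x≈fi x≉qs

    indices-distinct : ∀ {qs} (ix : Indexing qs) →
                       AllPairs _≉_ (map proj₁ qs) → AllPairs _≢_ (reduce proj₁ ix)
    indices-distinct []                []             = []
    indices-distinct ((i , x≈fi) ∷ ix) (x≉qs ∷ qs!) =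
      indexing-all ix x≈fi x≉qs ∷ indices-distinct ix qs!

  -- For involutions the signs of a relation can be dropped, and its distinct letters
  -- come from distinct indices.
  involutions-dissociated :
    (∀ i → f i ⁻¹ ≈ f i) →
    (∀ i is → AllPairs _≢_ (i ∷ is) → ¬ signedProduct G (positiveWord (i ∷ is)) ≈ ε) →
    ∀ xs → Dissociated G (map f xs)
  involutions-dissociated involutive nontrivial xs p ps distinct ⊆image w≈ε
    with ix@((i , _) ∷ ix′) ← indexing {xs} (p ∷ ps) ⊆image =
    nontrivial i (reduce proj₁ ix′) (indices-distinct ix distinct)
      (trans (sym (word≈positiveWord involutive ix)) w≈ε)

module _ where
  open Group S₃

  _≈?_ : (π ρ : Permutation′ 3) → Dec (π ≈ ρ)
  π ≈? ρ = all? λ i → π ⟨$⟩ʳ i ≟ ρ ⟨$⟩ʳ i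

  transposition : Fin 3 → Permutation′ 3
  transposition 0F = transpose 0F 1F
  transposition 1F = transpose 0F 2F
  transposition 2F = transpose 1F 2F

  transpositions : List (Permutation′ 3)
  transpositions = map transposition (allFin 3)

  Distinct : List (Fin 3) → Set
  Distinct = AllPairs _≢_

  distinct? : ∀ is → Dec (Distinct is)
  distinct? = allPairs? λ i j → ¬? (i ≟ j)

  S₃-enumeration : Fin 6 → Permutation′ 3
  S₃-enumeration = lookup (Perm.id ∷ transposition 0F ∷ transposition 1F ∷ transposition 2F
                          ∷ transposition 0F ∘ₚ transposition 1F
                          ∷ transposition 1F ∘ₚ transposition 0F ∷ [])

  HasSize-S₃ : HasSize S₃ 6
  HasSize-S₃ = S₃-enumeration , (λ {i} {j} → enumeration-injective i j) , enumeration-surjective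
    where
    enumeration-injective : ∀ i j → S₃-enumeration i ≈ S₃-enumeration j → i ≡ j
    enumeration-injective =
      toWitness {a? = all? λ i → all? λ j →
        (S₃-enumeration i ≈? S₃-enumeration j) →-dec (i ≟ j)} _

    values-distinct : ∀ σ → Distinct (map (σ ⟨$⟩ʳ_) (allFin 3))
    values-distinct σ = UniqueP.map⁺ (Injection.injective (↔⇒↣ σ)) (UniqueP.allFin⁺ 3)

    distinct-values-realised : ∀ a b c → Distinct (a ∷ b ∷ c ∷ []) →
      ∃ λ i → ∀ x → S₃-enumeration i ⟨$⟩ʳ x ≡ lookup (a ∷ b ∷ c ∷ []) x
    distinct-values-realised = toWitness {a? = all? λ a → all? λ b → all? λ c →
      distinct? (a ∷ b ∷ c ∷ []) →-dec
        any? λ i → all? λ x → S₃-enumeration i ⟨$⟩ʳ x ≟ lookup (a ∷ b ∷ c ∷ []) x} _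

    enumeration-surjective : ∀ σ → ∃ λ i → ∀ {j} → j ≡ i → S₃-enumeration j ≈ σ
    enumeration-surjective σ =
      let i , realised = distinct-values-realised _ _ _ (values-distinct σ)
      in i , λ { ≡.refl x → ≡.trans (realised x) (lookup-values x) }
      where
      lookup-values : ∀ x →
        lookup ((σ ⟨$⟩ʳ 0F) ∷ (σ ⟨$⟩ʳ 1F) ∷ (σ ⟨$⟩ʳ 2F) ∷ []) x ≡ σ ⟨$⟩ʳ x
      lookup-values 0F = ≡.refl
      lookup-values 1F = ≡.refl
      lookup-values 2F = ≡.refl

  transposition-involutive : ∀ i → transposition i ⁻¹ ≈ transposition i
  transposition-involutive = toWitness {a? = all? λ i → (transposition i ⁻¹) ≈? transposition i} _

  NontrivialIfDistinct : List (Fin 3) → Set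
  NontrivialIfDistinct is = Distinct is → ¬ signedProduct S₃ (positiveWord S₃ transposition is) ≈ ε

  nontrivialIfDistinct? : ∀ is → Dec (NontrivialIfDistinct is)
  nontrivialIfDistinct? is =
    distinct? is →-dec ¬? (signedProduct S₃ (positiveWord S₃ transposition is) ≈? ε)

  private

    nontrivial₁ : ∀ i → NontrivialIfDistinct (i ∷ [])
    nontrivial₁ = toWitness {a? = all? λ i → nontrivialIfDistinct? (i ∷ [])} _

    nontrivial₂ : ∀ i j → NontrivialIfDistinct (i ∷ j ∷ [])
    nontrivial₂ = toWitness {a? = all? λ i → all? λ j → nontrivialIfDistinct? (i ∷ j ∷ [])} _

    nontrivial₃ : ∀ i j k → NontrivialIfDistinct (i ∷ j ∷ k ∷ [])
    nontrivial₃ = toWitness {a? = all? λ i → all? λ j → all? λ k →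
      nontrivialIfDistinct? (i ∷ j ∷ k ∷ [])} _

    no-four-distinct : ∀ i j k l → ¬ Distinct (i ∷ j ∷ k ∷ l ∷ [])
    no-four-distinct = toWitness {a? = all? λ i → all? λ j → all? λ k → all? λ l →
      ¬? (distinct? (i ∷ j ∷ k ∷ l ∷ []))} _

  -- A product of one or three distinct transpositions is odd, and one of two distinct
  -- transpositions is a 3-cycle.
  transpositions-nontrivial : ∀ i is → NontrivialIfDistinct (i ∷ is)
  transpositions-nontrivial i []                = nontrivial₁ i
  transpositions-nontrivial i (j ∷ [])          = nontrivial₂ i j
  transpositions-nontrivial i (j ∷ k ∷ [])      = nontrivial₃ i j k
  transpositions-nontrivial i (j ∷ k ∷ l ∷ _) distinct =
    ⊥-elim (no-four-distinct i j k l (AllPairs.take⁺ 4 distinct))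

  transpositions-dissociated : Dissociated S₃ transpositions
  transpositions-dissociated =
    involutions-dissociated S₃ transposition
      transposition-involutive transpositions-nontrivial (allFin 3)

  transpositions-unique : IsFinSubset S₃ transpositions
  transpositions-unique = toWitness {a? = allPairs? (λ π ρ → ¬? (π ≈? ρ)) transpositions} _

  transpositions-order2 : All (HasOrder2 S₃) transpositions
  transpositions-order2 =
    toWitness {a? = All.all? (λ π → ¬? (π ≈? ε) ×-dec ((π ∙ π) ≈? ε)) transpositions} _

mainTheorem13 : ∀ {c ℓ : Level} →
    ((G : Group c ℓ) (m d : ℕ) → HasSize G m → IsDim G d →
      (k : ℕ) → 1 ≤ k → (D N : ℕ) → IsDim (G ^ᴳ k) D → HasSize (G ^ᴳ k) N →
      N ^ d ≤ m ^ D)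
    × ((k : ℕ) → 1 ≤ k → (D N : ℕ) → IsDim (S₃ ^ᴳ k) D → HasSize (S₃ ^ᴳ k) N →
      N ^ 3 ≤ 6 ^ D)
    × ((k : ℕ) → 1 ≤ k → (N : ℕ) → HasSize (S₃ ^ᴳ k) N →
      Σ (List (Group.Carrier (S₃ ^ᴳ k))) (λ Z →
        IsFinSubset (S₃ ^ᴳ k) Z × Dissociated (S₃ ^ᴳ k) Z
        × 6 ^ length Z ≡ N ^ 3 × All (HasOrder2 (S₃ ^ᴳ k)) Z))
mainTheorem13 =
    (λ { G m d |G|≡m ((S , S-unique , S-dissociated , ≡.refl) , _) k _ D N dim≡D |Gᵏ|≡N →
         dim-^ᴳ-size-bound G S |G|≡m S-unique S-dissociated k dim≡D |Gᵏ|≡N })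
  , (λ k _ D N dim≡D |S₃ᵏ|≡N →
         dim-^ᴳ-size-bound S₃ transpositions HasSize-S₃
           transpositions-unique transpositions-dissociated k dim≡D |S₃ᵏ|≡N)
  , λ k _ N |S₃ᵏ|≡N →
         Z k
       , coordinateCopies-unique S₃ transpositions transpositions-unique transpositions-dissociated k
       , coordinateCopies-dissociated S₃ transpositions transpositions-dissociated k
       , 6^|Z|≡N³ k |S₃ᵏ|≡N
       , coordinateCopies-order2 S₃ transpositions transpositions-order2 k
  where
  Z : ∀ k → List (Group.Carrier (S₃ ^ᴳ k))
  Z = coordinateCopies S₃ transpositions

  6^|Z|≡N³ : ∀ k {N} → HasSize (S₃ ^ᴳ k) N → 6 ^ length (Z k) ≡ N ^ 3
  6^|Z|≡N³ k {N} |S₃ᵏ|≡N = begin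
    6 ^ length (Z k)  ≡⟨ ≡.cong (6 ^_) (length-coordinateCopies S₃ transpositions k) ⟩
    6 ^ (k * 3)       ≡⟨ ^-*-assoc 6 k 3 ⟨
    (6 ^ k) ^ 3       ≡⟨ ≡.cong (_^ 3) (HasSize-^ᴳ-unique S₃ HasSize-S₃ k |S₃ᵏ|≡N) ⟨
    N ^ 3             ∎
    where open ≡.≡-Reasoning
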